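{- If $\Phi\vdash\psi$ in the natural deduction system for $\mathsf{BSML}^{\sqcup}$, then $\Phi\vDash\psi$.
   Context: Formulas of $\mathsf{BSML}^{\sqcup}$: $\phi ::= p \mid \neg\phi \mid \phi\wedge\phi \mid \phi\vee\phi \mid \phi\sqcup\phi\mid \Diamond\phi \mid \mathrm{NE}$; $\mathsf{ML}$ is the fragment without $\mathrm{NE}$ and $\sqcup$; $\Box\phi:=\neg\Diamond\neg\phi$, $\bot:=p\wedge\neg p$, $\bot\!\!\!\bot:=\bot\wedge\mathrm{NE}$. Semantics on Kripke models $M=(W,R,V)$ and states $s\subseteq W$ ($R[w]=\{v\mid wRv\}$), support $\vDash$ / anti-support $\mathrel{=\!\!\mid}$: $s\vDash p$ iff $s\subseteq V(p)$; $s\mathrel{=\!\!\mid} p$ iff $s\cap V(p)=\emptyset$; $s\vDash\mathrm{NE}$ iff $s\neq\emptyset$; $s\mathrel{=\!\!\mid}\mathrm{NE}$ iff $s=\emptyset$; $s\vDash\neg\phi$ iff $s\mathrel{=\!\!\mid}\phi$; $s\mathrel{=\!\!\mid}\neg\phi$ iff $s\vDash\phi$; $s\vDash\phi\wedge\psi$ iff both supported; $s\mathrel{=\!\!\mid}\phi\wedge\psi$ iff $s=t\cup u$, $t\mathrel{=\!\!\mid}\phi$, $u\mathrel{=\!\!\mid}\psi$; $s\vDash\phi\vee\psi$ iff $s=t\cup u$, $t\vDash\phi$, $u\vDash\psi$; $s\mathrel{=\!\!\mid}\phi\vee\psi$ iff both anti-supported; $s\vDash\phi\sqcup\psi$ iff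 $s\vDash\phi$ or $s\vDash\psi$; $s\mathrel{=\!\!\mid}\phi\sqcup\psi$ iff both anti-supported; $s\vDash\Diamond\phi$ iff every $w\in s$ has nonempty $t\subseteq R[w]$ with $t\vDash\phi$; $s\mathrel{=\!\!\mid}\Diamond\phi$ iff $R[w]\mathrel{=\!\!\mid}\phi$ for all $w\in s$. $\Phi\vDash\psi$: every $M,s$ supporting all of $\Phi$ supports $\psi$. The natural deduction system (metavariables $\alpha,\beta$ range over $\mathsf{ML}$ only; "$\dashv\vdash$" means both directions are rules; no uniform substitution) has rules: $\wedge$I, $\wedge$E (standard); $\neg$I: from a derivation of $\bot$ from $[\alpha]$ infer $\neg\alpha$, if undischarged assumptions contain no $\mathrm{NE}$; $\neg$E: $\alpha,\neg\alpha\vdash\beta$; $\neg\neg\phi\dashv\vdash\phi$; $\neg(\phi\wedge\psi)\dashv\vdash\neg\phi\vee\neg\psi$; $\neg(\phi\vee\psi)\dashv\vdash\neg\phi\wedge\neg\psi$; $\neg\mathrm{NE}\dashv\vdash\bot$; $\vee$I: $\phi\vdash\phi\vee\psi$ if $\psi$ contains no $\mathrm{NE}$; $\phi\vdash\phi\vee\phi$; $\phi\vee\psi\vdash\psi\vee\phi$; $\vee$E: from $\phi\vee\psi$ and derivations of $\chi$ from $[\phi]$ and from $[\psi]$ infer $\chi$, if the undischarged assumptions of those derivations contain no $\mathrm{NE}$ and $\chi$ contains no $\sqcup$; $\vee$Mon: from $\phi\vee\psi$ and a derivation of $\chi$ from $[\psi]$ (other undischarged assumptions $\mathrm{NE}$-free)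 infer $\phi\vee\chi$; $\bot\vee\phi\vdash\phi$; $\bot\!\!\!\bot\vee\phi\vdash\psi$; $\Diamond$Mon: from a derivation of $\psi$ from $[\phi]$ with no other undischarged assumptions and $\Diamond\phi$ infer $\Diamond\psi$; $\Box$Mon: from a derivation of $\psi$ from $[\phi_1],\dots,[\phi_n]$ with no other undischarged assumptions and $\Box\phi_1,\dots,\Box\phi_n$ infer $\Box\psi$; $\neg\Diamond\phi\dashv\vdash\Box\neg\phi$; $\Diamond(\phi\vee(\psi\wedge\mathrm{NE}))\vdash\Diamond\psi$; $\Diamond\phi,\Diamond\psi\vdash\Diamond(\phi\vee\psi)$; $\Box(\phi\wedge\mathrm{NE})\vdash\Diamond\phi$; $\Box\phi,\Diamond\psi\vdash\Box(\phi\vee\psi)$; $\phi\vdash\phi\sqcup\psi$, $\psi\vdash\phi\sqcup\psi$; $\sqcup$E (standard proof by cases); $\phi\vee(\psi\sqcup\chi)\vdash(\phi\vee\psi)\sqcup(\phi\vee\chi)$; $\neg(\phi\sqcup\psi)\dashv\vdash\neg\phi\wedge\neg\psi$; $\vdash\bot\sqcup\mathrm{NE}$; $\Diamond(\phi\sqcup\psi)\dashv\vdash\Diamond\phi\vee\Diamond\psi$; $\Box(\phi\sqcup\psi)\dashv\vdash\Box\phi\vee\Box\psi$. -}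

module Defs where

open import Level using (Level; Lift; 0ℓ) renaming (suc to lsuc)
open import Data.Nat using (ℕ)
open import Data.Empty using (⊥)
open import Data.Product using (Σ; ∃; _×_)
open import Data.Sum using (_⊎_)
open import Data.List using (List; []; _∷_; _++_; [_])
open import Data.List.Relation.Unary.All using (All)
open import Data.List.Relation.Binary.Subset.Propositional using (_⊆_)
open import Relation.Nullary using (¬_)
open import Function.Bundles using (_⇔_)

infix  9 ~_
infix  9 ◇_
infix  9 □_
infixl 7 _∧'_
infixl 6 _∨'_
infixl 5 _⊔'_

data Form : Set where
  atom  : ℕ → Form
  ~_    : Form → Form
  _∧'_  : Form → Form → Form
  _∨'_  : Form → Form → Form
  _⊔'_  : Form → Form → Form
  ◇_    : Form → Form
  NE    : Form

□_ : Form → Form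
□ φ = ~ ◇ ~ φ

⊥f : Form
⊥f = atom 0 ∧' ~ atom 0

⊥⊥ : Form
⊥⊥ = ⊥f ∧' NE

data NEfree : Form → Set where
  nf-atom : ∀ {n} → NEfree (atom n)
  nf-~ : ∀ {φ} → NEfree φ → NEfree (~ φ)
  nf-∧ : ∀ {φ ψ} → NEfree φ → NEfree ψ → NEfree (φ ∧' ψ)
  nf-∨ : ∀ {φ ψ} → NEfree φ → NEfree ψ → NEfree (φ ∨' ψ)
  nf-⊔ : ∀ {φ ψ} → NEfree φ → NEfree ψ → NEfree (φ ⊔' ψ)
  nf-◇ : ∀ {φ} → NEfree φ → NEfree (◇ φ)

data ⊔free : Form → Set where
  sf-atom : ∀ {n} → ⊔free (atom n)
  sf-~ : ∀ {φ} → ⊔free φ → ⊔free (~ φ)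
  sf-∧ : ∀ {φ ψ} → ⊔free φ → ⊔free ψ → ⊔free (φ ∧' ψ)
  sf-∨ : ∀ {φ ψ} → ⊔free φ → ⊔free ψ → ⊔free (φ ∨' ψ)
  sf-◇ : ∀ {φ} → ⊔free φ → ⊔free (◇ φ)
  sf-NE : ⊔free NE

ML : Form → Set
ML φ = NEfree φ × ⊔free φ

-- Natural deduction.  Γ ⊢ φ : there is a derivation of φ whose
-- undischarged assumptions are (among) the formulas in the list Γ.
-- Contexts of independent subderivations are concatenated; a rule that
-- discharges [φ] in a subderivation with assumptions Δ requires
-- Δ ⊆ φ ∷ Θ, where Θ are the remaining (undischarged) assumptions.

infix 4 _⊢_ _⊢□*_

mutual
  data _⊢_ : List Form → Form → Set where
    assume : ∀ {φ} → [ φ ] ⊢ φ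
    ∧I  : ∀ {Γ Δ φ ψ} → Γ ⊢ φ → Δ ⊢ ψ → Γ ++ Δ ⊢ φ ∧' ψ
    ∧E₁ : ∀ {Γ φ ψ} → Γ ⊢ φ ∧' ψ → Γ ⊢ φ
    ∧E₂ : ∀ {Γ φ ψ} → Γ ⊢ φ ∧' ψ → Γ ⊢ ψ
    ¬I  : ∀ {Γ Θ α} → ML α → Γ ⊢ ⊥f → Γ ⊆ α ∷ Θ → All NEfree Θ → Θ ⊢ ~ α
    ¬E  : ∀ {Γ Δ α β} → ML α → ML β → Γ ⊢ α → Δ ⊢ ~ α → Γ ++ Δ ⊢ β
    ¬¬E : ∀ {Γ φ} → Γ ⊢ ~ ~ φ → Γ ⊢ φ
    ¬¬I : ∀ {Γ φ} → Γ ⊢ φ → Γ ⊢ ~ ~ φ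
    dm∧₁ : ∀ {Γ φ ψ} → Γ ⊢ ~ (φ ∧' ψ) → Γ ⊢ ~ φ ∨' ~ ψ
    dm∧₂ : ∀ {Γ φ ψ} → Γ ⊢ ~ φ ∨' ~ ψ → Γ ⊢ ~ (φ ∧' ψ)
    dm∨₁ : ∀ {Γ φ ψ} → Γ ⊢ ~ (φ ∨' ψ) → Γ ⊢ ~ φ ∧' ~ ψ
    dm∨₂ : ∀ {Γ φ ψ} → Γ ⊢ ~ φ ∧' ~ ψ → Γ ⊢ ~ (φ ∨' ψ)
    ¬NE₁ : ∀ {Γ} → Γ ⊢ ~ NE → Γ ⊢ ⊥f
    ¬NE₂ : ∀ {Γ} → Γ ⊢ ⊥f → Γ ⊢ ~ NE
    ∨I    : ∀ {Γ φ ψ} → NEfree ψ → Γ ⊢ φ → Γ ⊢ φ ∨' ψ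
    ∨Idem : ∀ {Γ φ} → Γ ⊢ φ → Γ ⊢ φ ∨' φ
    ∨Comm : ∀ {Γ φ ψ} → Γ ⊢ φ ∨' ψ → Γ ⊢ ψ ∨' φ
    ∨E    : ∀ {Γ Δ₁ Δ₂ Θ φ ψ χ} → Γ ⊢ φ ∨' ψ →
            Δ₁ ⊢ χ → Δ₁ ⊆ φ ∷ Θ → Δ₂ ⊢ χ → Δ₂ ⊆ ψ ∷ Θ →
            All NEfree Θ → ⊔free χ → Γ ++ Θ ⊢ χ
    ∨Mon  : ∀ {Γ Δ Θ φ ψ χ} → Γ ⊢ φ ∨' ψ →
            Δ ⊢ χ → Δ ⊆ ψ ∷ Θ → All NEfree Θ → Γ ++ Θ ⊢ φ ∨' χ
    ⊥∨    : ∀ {Γ φ} → Γ ⊢ ⊥f ∨' φ → Γ ⊢ φ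
    ⊥⊥∨   : ∀ {Γ φ ψ} → Γ ⊢ ⊥⊥ ∨' φ → Γ ⊢ ψ
    ◇Mon  : ∀ {Γ Δ φ ψ} → Δ ⊢ ψ → Δ ⊆ [ φ ] → Γ ⊢ ◇ φ → Γ ⊢ ◇ ψ
    □Mon  : ∀ {Γ Δ φs ψ} → Δ ⊢ ψ → Δ ⊆ φs → Γ ⊢□* φs → Γ ⊢ □ ψ
    ¬◇₁   : ∀ {Γ φ} → Γ ⊢ ~ ◇ φ → Γ ⊢ □ ~ φ
    ¬◇₂   : ∀ {Γ φ} → Γ ⊢ □ ~ φ → Γ ⊢ ~ ◇ φ
    ◇NE   : ∀ {Γ φ ψ} → Γ ⊢ ◇ (φ ∨' (ψ ∧' NE)) → Γ ⊢ ◇ ψ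
    ◇∨    : ∀ {Γ Δ φ ψ} → Γ ⊢ ◇ φ → Δ ⊢ ◇ ψ → Γ ++ Δ ⊢ ◇ (φ ∨' ψ)
    □NE   : ∀ {Γ φ} → Γ ⊢ □ (φ ∧' NE) → Γ ⊢ ◇ φ
    □◇∨   : ∀ {Γ Δ φ ψ} → Γ ⊢ □ φ → Δ ⊢ ◇ ψ → Γ ++ Δ ⊢ □ (φ ∨' ψ)
    ⊔I₁   : ∀ {Γ φ ψ} → Γ ⊢ φ → Γ ⊢ φ ⊔' ψ
    ⊔I₂   : ∀ {Γ φ ψ} → Γ ⊢ ψ → Γ ⊢ φ ⊔' ψ
    ⊔E    : ∀ {Γ Δ₁ Δ₂ Θ φ ψ χ} → Γ ⊢ φ ⊔' ψ →
            Δ₁ ⊢ χ → Δ₁ ⊆ φ ∷ Θ → Δ₂ ⊢ χ → Δ₂ ⊆ ψ ∷ Θ → Γ ++ Θ ⊢ χ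
    ∨⊔Distr : ∀ {Γ φ ψ χ} → Γ ⊢ φ ∨' (ψ ⊔' χ) → Γ ⊢ (φ ∨' ψ) ⊔' (φ ∨' χ)
    ¬⊔₁   : ∀ {Γ φ ψ} → Γ ⊢ ~ (φ ⊔' ψ) → Γ ⊢ ~ φ ∧' ~ ψ
    ¬⊔₂   : ∀ {Γ φ ψ} → Γ ⊢ ~ φ ∧' ~ ψ → Γ ⊢ ~ (φ ⊔' ψ)
    ⊥⊔NE  : [] ⊢ ⊥f ⊔' NE
    ◇⊔₁   : ∀ {Γ φ ψ} → Γ ⊢ ◇ (φ ⊔' ψ) → Γ ⊢ ◇ φ ∨' ◇ ψ
    ◇⊔₂   : ∀ {Γ φ ψ} → Γ ⊢ ◇ φ ∨' ◇ ψ → Γ ⊢ ◇ (φ ⊔' ψ)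
    □⊔₁   : ∀ {Γ φ ψ} → Γ ⊢ □ (φ ⊔' ψ) → Γ ⊢ □ φ ∨' □ ψ
    □⊔₂   : ∀ {Γ φ ψ} → Γ ⊢ □ φ ∨' □ ψ → Γ ⊢ □ (φ ⊔' ψ)

  data _⊢□*_ : List Form → List Form → Set where
    []  : [] ⊢□* []
    _∷_ : ∀ {Γ Δ φ φs} → Γ ⊢ □ φ → Δ ⊢□* φs → Γ ++ Δ ⊢□* (φ ∷ φs)

_⊢ₛ_ : (Form → Set) → Form → Set
Φ ⊢ₛ ψ = Σ (List Form) λ Γ → All Φ Γ × Γ ⊢ ψ

record Model : Set₁ where
  field
    W : Set
    R : W → W → Set
    V : ℕ → W → Set

State : Model → Set₁
State M = Model.W M → Set

_≡_∪_ : ∀ {M : Model} → State M → State M → State M → Set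
_≡_∪_ {M} s t u = ∀ (w : Model.W M) → s w ⇔ (t w ⊎ u w)

R[_] : ∀ {M : Model} → Model.W M → State M
R[_] {M} w = Model.R M w

mutual
  _,_⊨_ : (M : Model) → State M → Form → Set₁
  M , s ⊨ (atom p) = Lift (lsuc 0ℓ) (∀ w → s w → Model.V M p w)
  M , s ⊨ (~ φ) = M , s ⫤ φ
  M , s ⊨ (φ ∧' ψ) = (M , s ⊨ φ) × (M , s ⊨ ψ)
  M , s ⊨ (φ ∨' ψ) = Σ (State M) λ t → Σ (State M) λ u →
                       (_≡_∪_ {M} s t u) × (M , t ⊨ φ) × (M , u ⊨ ψ)
  M , s ⊨ (φ ⊔' ψ) = (M , s ⊨ φ) ⊎ (M , s ⊨ ψ)
  M , s ⊨ (◇ φ) = ∀ w → s w → Σ (State M) λ t →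
                  (∀ v → t v → Model.R M w v) × (∃ λ v → t v) × (M , t ⊨ φ)
  M , s ⊨ NE = Lift (lsuc 0ℓ) (∃ λ w → s w)

  _,_⫤_ : (M : Model) → State M → Form → Set₁
  M , s ⫤ (atom p) = Lift (lsuc 0ℓ) (∀ w → s w → ¬ Model.V M p w)
  M , s ⫤ (~ φ) = M , s ⊨ φ
  M , s ⫤ (φ ∧' ψ) = Σ (State M) λ t → Σ (State M) λ u →
                       (_≡_∪_ {M} s t u) × (M , t ⫤ φ) × (M , u ⫤ ψ)
  M , s ⫤ (φ ∨' ψ) = (M , s ⫤ φ) × (M , s ⫤ ψ)
  M , s ⫤ (φ ⊔' ψ) = (M , s ⫤ φ) × (M , s ⫤ ψ)
  M , s ⫤ (◇ φ) = ∀ w → s w → M , R[_] {M} w ⫤ φ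
  M , s ⫤ NE = Lift (lsuc 0ℓ) (∀ w → ¬ s w)

_⊨ₛ_ : (Form → Set) → Form → Set₁
Φ ⊨ₛ ψ = ∀ (M : Model) (s : State M) →
           (∀ φ → Φ φ → M , s ⊨ φ) → M , s ⊨ ψ

{-# OPTIONS --safe #-}
-- Soundness is proved by induction on derivations, checking each rule against
-- the standard properties of state semantics: NE-free formulas are downward
-- closed and hold (positively and negatively) on the empty state, ⊔-free
-- formulas are closed under unions, and no nonempty state both supports and
-- anti-supports an NE-free formula.  Classically, ML formulas are moreover flat
-- (support is decided world by world) and every singleton supports or
-- anti-supports them, which is what validates ¬I.  Excluded middle also splits a
-- state along a pointwise disjunction, which validates ◇⊔ and □⊔ distribution.
module Submission where

open import Defs
open import Axiom.ExcludedMiddle using (ExcludedMiddle)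
open import Level using (lift; lower)
open import Data.Empty using (⊥-elim)
open import Data.Product using (Σ; _×_; _,_; proj₁; proj₂)
open import Data.Sum as Sum using (_⊎_; inj₁; inj₂; [_,_]; swap)
open import Data.List using (List)
open import Data.List.Relation.Unary.All as All using (All; []; _∷_)
open import Data.List.Relation.Unary.All.Properties using (++⁻ˡ; ++⁻ʳ; anti-mono)
open import Relation.Nullary using (¬_; yes; no)
open import Relation.Nullary.Decidable using (True; toWitness; fromWitness)
open import Relation.Unary using (_∈_; _⊆′_; ∅; ｛_｝; _∪_; _∩_; Empty; Satisfiable)
open import Relation.Binary.PropositionalEquality using (refl)
open import Function using (_∘_; id)
open import Function.Bundles using (mk⇔; Equivalence)

⊥f-NEfree : NEfree ⊥f
⊥f-NEfree = nf-∧ nf-atom (nf-~ nf-atom)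

∈⇒｛｝⊆ : ∀ {A : Set} {s : A → Set} {w : A} → w ∈ s → ｛ w ｝ ⊆′ s
∈⇒｛｝⊆ x _ refl = x

module SupportProperties {M : Model} where
  open Model M

  private variable
    s s′ t u t₁ t₂ u₁ u₂ : State M

  infix 4 _⊨*_

  _⊨*_ : State M → List Form → Set₁
  s ⊨* Γ = All (λ φ → M , s ⊨ φ) Γ

  ≡∪-intro : s ⊆′ t ∪ u → t ⊆′ s → u ⊆′ s → _≡_∪_ {M} s t u
  ≡∪-intro s⊆t∪u t⊆s u⊆s w = mk⇔ (s⊆t∪u w) [ t⊆s w , u⊆s w ]

  ≡∪⇒⊆ : _≡_∪_ {M} s t u → s ⊆′ t ∪ u
  ≡∪⇒⊆ e w = Equivalence.to (e w)

  ≡∪⇒⊇ˡ : _≡_∪_ {M} s t u → t ⊆′ s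
  ≡∪⇒⊇ˡ e w = Equivalence.from (e w) ∘ inj₁

  ≡∪⇒⊇ʳ : _≡_∪_ {M} s t u → u ⊆′ s
  ≡∪⇒⊇ʳ e w = Equivalence.from (e w) ∘ inj₂

  ≡∪-respˡ : s ⊆′ s′ → s′ ⊆′ s → _≡_∪_ {M} s t u → _≡_∪_ {M} s′ t u
  ≡∪-respˡ s⊆s′ s′⊆s e =
    ≡∪-intro (λ w → ≡∪⇒⊆ e w ∘ s′⊆s w) (λ w → s⊆s′ w ∘ ≡∪⇒⊇ˡ e w) (λ w → s⊆s′ w ∘ ≡∪⇒⊇ʳ e w)

  ≡∪-restrict : s′ ⊆′ s → _≡_∪_ {M} s t u → _≡_∪_ {M} s′ (s′ ∩ t) (s′ ∩ u)
  ≡∪-restrict s′⊆s e =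
    ≡∪-intro (λ w x → Sum.map (x ,_) (x ,_) (≡∪⇒⊆ e w (s′⊆s w x))) (λ _ → proj₁) (λ _ → proj₁)

  ≡∪-emptyˡ : _≡_∪_ {M} s t u → Empty t → s ⊆′ u
  ≡∪-emptyˡ e t-empty w x = [ (λ y → ⊥-elim (t-empty w y)) , id ] (≡∪⇒⊆ e w x)

  ≡∪-comm : _≡_∪_ {M} s t u → _≡_∪_ {M} s u t
  ≡∪-comm e = ≡∪-intro (λ w → swap ∘ ≡∪⇒⊆ e w) (≡∪⇒⊇ʳ e) (≡∪⇒⊇ˡ e)

  ≡∪-absorbʳ : u ⊆′ s → _≡_∪_ {M} s s u
  ≡∪-absorbʳ = ≡∪-intro (λ _ → inj₁) (λ _ → id)

  ≡∪-idem : _≡_∪_ {M} s s s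
  ≡∪-idem = ≡∪-absorbʳ (λ _ → id)

  ≡∪-∅ : _≡_∪_ {M} s s ∅
  ≡∪-∅ = ≡∪-absorbʳ (λ _ ())

  ≡∪-refl : _≡_∪_ {M} (t ∪ u) t u
  ≡∪-refl = ≡∪-intro (λ _ → id) (λ _ → inj₁) (λ _ → inj₂)

  ≡∪-interchange : _≡_∪_ {M} s t u →
                   _≡_∪_ {M} t t₁ t₂ → _≡_∪_ {M} u u₁ u₂ → _≡_∪_ {M} s (t₁ ∪ u₁) (t₂ ∪ u₂)
  ≡∪-interchange e e₁ e₂ = ≡∪-intro
    (λ w → [ Sum.map inj₁ inj₁ ∘ ≡∪⇒⊆ e₁ w , Sum.map inj₂ inj₂ ∘ ≡∪⇒⊆ e₂ w ] ∘ ≡∪⇒⊆ e w)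
    (λ w → [ ≡∪⇒⊇ˡ e w ∘ ≡∪⇒⊇ˡ e₁ w , ≡∪⇒⊇ʳ e w ∘ ≡∪⇒⊇ˡ e₂ w ])
    (λ w → [ ≡∪⇒⊇ˡ e w ∘ ≡∪⇒⊇ʳ e₁ w , ≡∪⇒⊇ʳ e w ∘ ≡∪⇒⊇ʳ e₂ w ])

  ｛｝-≡∪ : ∀ {w} {t u : State M} → _≡_∪_ {M} ｛ w ｝ t u → ｛ w ｝ ⊆′ t ⊎ ｛ w ｝ ⊆′ u
  ｛｝-≡∪ e = Sum.map ∈⇒｛｝⊆ ∈⇒｛｝⊆ (≡∪⇒⊆ e _ refl)

  mutual
    ⊨-resp-≐ : ∀ {s s′} φ → s ⊆′ s′ → s′ ⊆′ s → M , s ⊨ φ → M , s′ ⊨ φ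
    ⊨-resp-≐ (atom p) _ s′⊆s (lift h) = lift λ w → h w ∘ s′⊆s w
    ⊨-resp-≐ (~ φ) s⊆s′ s′⊆s h = ⫤-resp-≐ φ s⊆s′ s′⊆s h
    ⊨-resp-≐ (φ ∧' ψ) s⊆s′ s′⊆s (a , b) = ⊨-resp-≐ φ s⊆s′ s′⊆s a , ⊨-resp-≐ ψ s⊆s′ s′⊆s b
    ⊨-resp-≐ (φ ∨' ψ) s⊆s′ s′⊆s (t , u , e , a , b) = t , u , ≡∪-respˡ s⊆s′ s′⊆s e , a , b
    ⊨-resp-≐ (φ ⊔' ψ) s⊆s′ s′⊆s = Sum.map (⊨-resp-≐ φ s⊆s′ s′⊆s) (⊨-resp-≐ ψ s⊆s′ s′⊆s)
    ⊨-resp-≐ (◇ φ) _ s′⊆s h w = h w ∘ s′⊆s w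
    ⊨-resp-≐ NE s⊆s′ _ (lift (w , x)) = lift (w , s⊆s′ w x)

    ⫤-resp-≐ : ∀ {s s′} φ → s ⊆′ s′ → s′ ⊆′ s → M , s ⫤ φ → M , s′ ⫤ φ
    ⫤-resp-≐ (atom p) _ s′⊆s (lift h) = lift λ w → h w ∘ s′⊆s w
    ⫤-resp-≐ (~ φ) s⊆s′ s′⊆s h = ⊨-resp-≐ φ s⊆s′ s′⊆s h
    ⫤-resp-≐ (φ ∧' ψ) s⊆s′ s′⊆s (t , u , e , a , b) = t , u , ≡∪-respˡ s⊆s′ s′⊆s e , a , b
    ⫤-resp-≐ (φ ∨' ψ) s⊆s′ s′⊆s (a , b) = ⫤-resp-≐ φ s⊆s′ s′⊆s a , ⫤-resp-≐ ψ s⊆s′ s′⊆s b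
    ⫤-resp-≐ (φ ⊔' ψ) s⊆s′ s′⊆s (a , b) = ⫤-resp-≐ φ s⊆s′ s′⊆s a , ⫤-resp-≐ ψ s⊆s′ s′⊆s b
    ⫤-resp-≐ (◇ φ) _ s′⊆s h w = h w ∘ s′⊆s w
    ⫤-resp-≐ NE _ s′⊆s (lift h) = lift λ w → h w ∘ s′⊆s w

  mutual
    ⊨-downClosed : ∀ {s s′ φ} → NEfree φ → s′ ⊆′ s → M , s ⊨ φ → M , s′ ⊨ φ
    ⊨-downClosed nf-atom s′⊆s (lift h) = lift λ w → h w ∘ s′⊆s w
    ⊨-downClosed (nf-~ n) s′⊆s h = ⫤-downClosed n s′⊆s h
    ⊨-downClosed (nf-∧ n₁ n₂) s′⊆s (a , b) = ⊨-downClosed n₁ s′⊆s a , ⊨-downClosed n₂ s′⊆s b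
    ⊨-downClosed {s′ = s′} (nf-∨ n₁ n₂) s′⊆s (t , u , e , a , b) =
      s′ ∩ t , s′ ∩ u , ≡∪-restrict s′⊆s e ,
      ⊨-downClosed n₁ (λ _ → proj₂) a , ⊨-downClosed n₂ (λ _ → proj₂) b
    ⊨-downClosed (nf-⊔ n₁ n₂) s′⊆s = Sum.map (⊨-downClosed n₁ s′⊆s) (⊨-downClosed n₂ s′⊆s)
    ⊨-downClosed (nf-◇ n) s′⊆s h w = h w ∘ s′⊆s w

    ⫤-downClosed : ∀ {s s′ φ} → NEfree φ → s′ ⊆′ s → M , s ⫤ φ → M , s′ ⫤ φ
    ⫤-downClosed nf-atom s′⊆s (lift h) = lift λ w → h w ∘ s′⊆s w
    ⫤-downClosed (nf-~ n) s′⊆s h = ⊨-downClosed n s′⊆s h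
    ⫤-downClosed {s′ = s′} (nf-∧ n₁ n₂) s′⊆s (t , u , e , a , b) =
      s′ ∩ t , s′ ∩ u , ≡∪-restrict s′⊆s e ,
      ⫤-downClosed n₁ (λ _ → proj₂) a , ⫤-downClosed n₂ (λ _ → proj₂) b
    ⫤-downClosed (nf-∨ n₁ n₂) s′⊆s (a , b) = ⫤-downClosed n₁ s′⊆s a , ⫤-downClosed n₂ s′⊆s b
    ⫤-downClosed (nf-⊔ n₁ n₂) s′⊆s (a , b) = ⫤-downClosed n₁ s′⊆s a , ⫤-downClosed n₂ s′⊆s b
    ⫤-downClosed (nf-◇ n) s′⊆s h w = h w ∘ s′⊆s w

  ⊨*-downClosed : ∀ {s s′ Θ} → All NEfree Θ → s′ ⊆′ s → s ⊨* Θ → s′ ⊨* Θ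
  ⊨*-downClosed [] _ [] = []
  ⊨*-downClosed (n ∷ ns) s′⊆s (h ∷ hs) = ⊨-downClosed n s′⊆s h ∷ ⊨*-downClosed ns s′⊆s hs

  mutual
    ⊨-empty : ∀ {s φ} → NEfree φ → Empty s → M , s ⊨ φ
    ⊨-empty nf-atom s-empty = lift λ w → ⊥-elim ∘ s-empty w
    ⊨-empty (nf-~ n) s-empty = ⫤-empty n s-empty
    ⊨-empty (nf-∧ n₁ n₂) s-empty = ⊨-empty n₁ s-empty , ⊨-empty n₂ s-empty
    ⊨-empty {s} (nf-∨ n₁ n₂) s-empty = s , s , ≡∪-idem , ⊨-empty n₁ s-empty , ⊨-empty n₂ s-empty
    ⊨-empty (nf-⊔ n₁ n₂) s-empty = inj₁ (⊨-empty n₁ s-empty)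
    ⊨-empty (nf-◇ n) s-empty w = ⊥-elim ∘ s-empty w

    ⫤-empty : ∀ {s φ} → NEfree φ → Empty s → M , s ⫤ φ
    ⫤-empty nf-atom s-empty = lift λ w → ⊥-elim ∘ s-empty w
    ⫤-empty (nf-~ n) s-empty = ⊨-empty n s-empty
    ⫤-empty {s} (nf-∧ n₁ n₂) s-empty = s , s , ≡∪-idem , ⫤-empty n₁ s-empty , ⫤-empty n₂ s-empty
    ⫤-empty (nf-∨ n₁ n₂) s-empty = ⫤-empty n₁ s-empty , ⫤-empty n₂ s-empty
    ⫤-empty (nf-⊔ n₁ n₂) s-empty = ⫤-empty n₁ s-empty , ⫤-empty n₂ s-empty
    ⫤-empty (nf-◇ n) s-empty w = ⊥-elim ∘ s-empty w

  mutual
    ⊨-unionClosed : ∀ {s t u φ} → ⊔free φ → _≡_∪_ {M} s t u → M , t ⊨ φ → M , u ⊨ φ → M , s ⊨ φ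
    ⊨-unionClosed sf-atom e (lift a) (lift b) = lift λ w → [ a w , b w ] ∘ ≡∪⇒⊆ e w
    ⊨-unionClosed (sf-~ f) e a b = ⫤-unionClosed f e a b
    ⊨-unionClosed (sf-∧ f₁ f₂) e (a₁ , a₂) (b₁ , b₂) = ⊨-unionClosed f₁ e a₁ b₁ , ⊨-unionClosed f₂ e a₂ b₂
    ⊨-unionClosed (sf-∨ f₁ f₂) e (t₁ , t₂ , e₁ , a₁ , a₂) (u₁ , u₂ , e₂ , b₁ , b₂) =
      t₁ ∪ u₁ , t₂ ∪ u₂ , ≡∪-interchange e e₁ e₂ ,
      ⊨-unionClosed f₁ ≡∪-refl a₁ b₁ , ⊨-unionClosed f₂ ≡∪-refl a₂ b₂
    ⊨-unionClosed (sf-◇ f) e a b w = [ a w , b w ] ∘ ≡∪⇒⊆ e w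
    ⊨-unionClosed sf-NE e (lift (w , x)) _ = lift (w , ≡∪⇒⊇ˡ e w x)

    ⫤-unionClosed : ∀ {s t u φ} → ⊔free φ → _≡_∪_ {M} s t u → M , t ⫤ φ → M , u ⫤ φ → M , s ⫤ φ
    ⫤-unionClosed sf-atom e (lift a) (lift b) = lift λ w → [ a w , b w ] ∘ ≡∪⇒⊆ e w
    ⫤-unionClosed (sf-~ f) e a b = ⊨-unionClosed f e a b
    ⫤-unionClosed (sf-∧ f₁ f₂) e (t₁ , t₂ , e₁ , a₁ , a₂) (u₁ , u₂ , e₂ , b₁ , b₂) =
      t₁ ∪ u₁ , t₂ ∪ u₂ , ≡∪-interchange e e₁ e₂ ,
      ⫤-unionClosed f₁ ≡∪-refl a₁ b₁ , ⫤-unionClosed f₂ ≡∪-refl a₂ b₂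
    ⫤-unionClosed (sf-∨ f₁ f₂) e (a₁ , a₂) (b₁ , b₂) = ⫤-unionClosed f₁ e a₁ b₁ , ⫤-unionClosed f₂ e a₂ b₂
    ⫤-unionClosed (sf-◇ f) e a b w = [ a w , b w ] ∘ ≡∪⇒⊆ e w
    ⫤-unionClosed sf-NE e (lift a) (lift b) = lift λ w → [ a w , b w ] ∘ ≡∪⇒⊆ e w

  ⊨-⫤-disjoint : ∀ {s φ} → NEfree φ → M , s ⊨ φ → M , s ⫤ φ → Empty s
  ⊨-⫤-disjoint nf-atom (lift a) (lift b) w x = b w x (a w x)
  ⊨-⫤-disjoint (nf-~ n) a b = ⊨-⫤-disjoint n b a
  ⊨-⫤-disjoint (nf-∧ n₁ n₂) (a₁ , a₂) (t , u , e , b₁ , b₂) w x with ≡∪⇒⊆ e w x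
  ... | inj₁ y = ⊨-⫤-disjoint n₁ (⊨-downClosed n₁ (≡∪⇒⊇ˡ e) a₁) b₁ w y
  ... | inj₂ y = ⊨-⫤-disjoint n₂ (⊨-downClosed n₂ (≡∪⇒⊇ʳ e) a₂) b₂ w y
  ⊨-⫤-disjoint (nf-∨ n₁ n₂) (t , u , e , a₁ , a₂) (b₁ , b₂) w x with ≡∪⇒⊆ e w x
  ... | inj₁ y = ⊨-⫤-disjoint n₁ a₁ (⫤-downClosed n₁ (≡∪⇒⊇ˡ e) b₁) w y
  ... | inj₂ y = ⊨-⫤-disjoint n₂ a₂ (⫤-downClosed n₂ (≡∪⇒⊇ʳ e) b₂) w y
  ⊨-⫤-disjoint (nf-⊔ n₁ n₂) (inj₁ a) (b₁ , _) = ⊨-⫤-disjoint n₁ a b₁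
  ⊨-⫤-disjoint (nf-⊔ n₁ n₂) (inj₂ a) (_ , b₂) = ⊨-⫤-disjoint n₂ a b₂
  ⊨-⫤-disjoint (nf-◇ n) a b w x with a w x
  ... | t , t⊆Rw , (v , y) , c = ⊨-⫤-disjoint n c (⫤-downClosed n t⊆Rw (b w x)) v y

  ⊨⊥f⇒Empty : ∀ {s} → M , s ⊨ ⊥f → Empty s
  ⊨⊥f⇒Empty (a , b) = ⊨-⫤-disjoint nf-atom a b

  -- M , s ⊨ ◇ φ unfolds to ∀ w → w ∈ s → PossiblyAt φ w.
  PossiblyAt : Form → W → Set₁
  PossiblyAt φ w = Σ (State M) λ t → t ⊆′ R w × Satisfiable t × (M , t ⊨ φ)

  PossiblyAt-⊔⁻ : ∀ {φ ψ w} → PossiblyAt (φ ⊔' ψ) w → PossiblyAt φ w ⊎ PossiblyAt ψ w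
  PossiblyAt-⊔⁻ (t , t⊆Rw , ne , inj₁ a) = inj₁ (t , t⊆Rw , ne , a)
  PossiblyAt-⊔⁻ (t , t⊆Rw , ne , inj₂ b) = inj₂ (t , t⊆Rw , ne , b)

  PossiblyAt-⊔⁺ : ∀ {φ ψ w} → PossiblyAt φ w ⊎ PossiblyAt ψ w → PossiblyAt (φ ⊔' ψ) w
  PossiblyAt-⊔⁺ (inj₁ (t , t⊆Rw , ne , a)) = t , t⊆Rw , ne , inj₁ a
  PossiblyAt-⊔⁺ (inj₂ (t , t⊆Rw , ne , b)) = t , t⊆Rw , ne , inj₂ b

  ｛｝-⊨∨ : ∀ {w φ ψ} → NEfree φ → NEfree ψ →
           M , ｛ w ｝ ⊨ (φ ∨' ψ) → (M , ｛ w ｝ ⊨ φ) ⊎ (M , ｛ w ｝ ⊨ ψ)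
  ｛｝-⊨∨ n₁ n₂ (t , u , e , a , b) =
    Sum.map (λ w⊆t → ⊨-downClosed n₁ w⊆t a) (λ w⊆u → ⊨-downClosed n₂ w⊆u b) (｛｝-≡∪ e)

  ｛｝-⫤∧ : ∀ {w φ ψ} → NEfree φ → NEfree ψ →
           M , ｛ w ｝ ⫤ (φ ∧' ψ) → (M , ｛ w ｝ ⫤ φ) ⊎ (M , ｛ w ｝ ⫤ ψ)
  ｛｝-⫤∧ n₁ n₂ (t , u , e , a , b) =
    Sum.map (λ w⊆t → ⫤-downClosed n₁ w⊆t a) (λ w⊆u → ⫤-downClosed n₂ w⊆u b) (｛｝-≡∪ e)

module Classical (em : ∀ {ℓ} → ExcludedMiddle ℓ) {M : Model} where
  open Model M
  open SupportProperties {M}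

  -- Squashes a Set₁-valued proposition into Set, so that it can carve out a state.
  Holds : Set₁ → Set
  Holds P = True (em {P = P})

  ≡∪-split : ∀ {s : State M} {P Q : W → Set₁} → (∀ w → w ∈ s → P w ⊎ Q w) →
             Σ (State M) λ t → Σ (State M) λ u →
               _≡_∪_ {M} s t u × (∀ w → w ∈ t → P w) × (∀ w → w ∈ u → Q w)
  ≡∪-split {s} {P} {Q} s⊆P∪Q =
    s ∩ (Holds ∘ P) , s ∩ (¬_ ∘ Holds ∘ P) ,
    ≡∪-intro decide (λ _ → proj₁) (λ _ → proj₁) ,
    (λ _ → toWitness ∘ proj₂) ,
    (λ w (x , ¬p) → [ (λ p → ⊥-elim (¬p (fromWitness p))) , id ] (s⊆P∪Q w x))
    where
    decide : s ⊆′ (s ∩ (Holds ∘ P)) ∪ (s ∩ (¬_ ∘ Holds ∘ P))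
    decide w x with em {P = Holds (P w)}
    ... | yes p = inj₁ (x , p)
    ... | no ¬p = inj₂ (x , ¬p)

  mutual
    ⊨-flat : ∀ {s φ} → NEfree φ → ⊔free φ → (∀ w → w ∈ s → M , ｛ w ｝ ⊨ φ) → M , s ⊨ φ
    ⊨-flat nf-atom sf-atom h = lift λ w x → lower (h w x) w refl
    ⊨-flat (nf-~ n) (sf-~ f) h = ⫤-flat n f h
    ⊨-flat (nf-∧ n₁ n₂) (sf-∧ f₁ f₂) h =
      ⊨-flat n₁ f₁ (λ w → proj₁ ∘ h w) , ⊨-flat n₂ f₂ (λ w → proj₂ ∘ h w)
    ⊨-flat (nf-∨ n₁ n₂) (sf-∨ f₁ f₂) h with ≡∪-split (λ w → ｛｝-⊨∨ n₁ n₂ ∘ h w)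
    ... | t , u , e , tφ , uψ = t , u , e , ⊨-flat n₁ f₁ tφ , ⊨-flat n₂ f₂ uψ
    ⊨-flat (nf-◇ n) (sf-◇ f) h w x = h w x w refl

    ⫤-flat : ∀ {s φ} → NEfree φ → ⊔free φ → (∀ w → w ∈ s → M , ｛ w ｝ ⫤ φ) → M , s ⫤ φ
    ⫤-flat nf-atom sf-atom h = lift λ w x → lower (h w x) w refl
    ⫤-flat (nf-~ n) (sf-~ f) h = ⊨-flat n f h
    ⫤-flat (nf-∧ n₁ n₂) (sf-∧ f₁ f₂) h with ≡∪-split (λ w → ｛｝-⫤∧ n₁ n₂ ∘ h w)
    ... | t , u , e , tφ , uψ = t , u , e , ⫤-flat n₁ f₁ tφ , ⫤-flat n₂ f₂ uψ
    ⫤-flat (nf-∨ n₁ n₂) (sf-∨ f₁ f₂) h =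
      ⫤-flat n₁ f₁ (λ w → proj₁ ∘ h w) , ⫤-flat n₂ f₂ (λ w → proj₂ ∘ h w)
    ⫤-flat (nf-◇ n) (sf-◇ f) h w x = h w x w refl

  mutual
    ｛｝-bivalent : ∀ {φ} → NEfree φ → ⊔free φ → ∀ w → (M , ｛ w ｝ ⊨ φ) ⊎ (M , ｛ w ｝ ⫤ φ)
    ｛｝-bivalent {atom p} nf-atom sf-atom w with em {P = V p w}
    ... | yes pw = inj₁ (lift λ { _ refl → pw })
    ... | no ¬pw = inj₂ (lift λ { _ refl → ¬pw })
    ｛｝-bivalent (nf-~ n) (sf-~ f) w = swap (｛｝-bivalent n f w)
    ｛｝-bivalent (nf-∧ n₁ n₂) (sf-∧ f₁ f₂) w with ｛｝-bivalent n₁ f₁ w | ｛｝-bivalent n₂ f₂ w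
    ... | inj₁ a | inj₁ b = inj₁ (a , b)
    ... | inj₂ a | _      = inj₂ (｛ w ｝ , ∅ , ≡∪-∅ , a , ⫤-empty n₂ (λ _ ()))
    ... | inj₁ _ | inj₂ b = inj₂ (∅ , ｛ w ｝ , ≡∪-comm ≡∪-∅ , ⫤-empty n₁ (λ _ ()) , b)
    ｛｝-bivalent (nf-∨ n₁ n₂) (sf-∨ f₁ f₂) w with ｛｝-bivalent n₁ f₁ w | ｛｝-bivalent n₂ f₂ w
    ... | inj₂ a | inj₂ b = inj₂ (a , b)
    ... | inj₁ a | _      = inj₁ (｛ w ｝ , ∅ , ≡∪-∅ , a , ⊨-empty n₂ (λ _ ()))
    ... | inj₂ _ | inj₁ b = inj₁ (∅ , ｛ w ｝ , ≡∪-comm ≡∪-∅ , ⊨-empty n₁ (λ _ ()) , b)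
    ｛｝-bivalent {◇ φ} (nf-◇ n) (sf-◇ f) w with em {P = Σ W λ v → R w v × (M , ｛ v ｝ ⊨ φ)}
    ... | yes (v , wRv , a) = inj₁ λ { _ refl → ｛ v ｝ , (λ { _ refl → wRv }) , (v , refl) , a }
    ... | no ¬∃v = inj₂ λ { _ refl → unsupported-｛｝⇒⫤ n f λ v wRv a → ¬∃v (v , wRv , a) }

    unsupported-｛｝⇒⫤ : ∀ {s α} → NEfree α → ⊔free α →
                         (∀ w → w ∈ s → ¬ (M , ｛ w ｝ ⊨ α)) → M , s ⫤ α
    unsupported-｛｝⇒⫤ n f h = ⫤-flat n f λ w x →
      [ (λ a → ⊥-elim (h w x a)) , id ] (｛｝-bivalent n f w)

  mutual
    sound : ∀ {Γ φ} → Γ ⊢ φ → ∀ s → s ⊨* Γ → M , s ⊨ φ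
    sound assume s (a ∷ []) = a
    sound (∧I {Γ} d₁ d₂) s H = sound d₁ s (++⁻ˡ Γ H) , sound d₂ s (++⁻ʳ Γ H)
    sound (∧E₁ d) s H = proj₁ (sound d s H)
    sound (∧E₂ d) s H = proj₂ (sound d s H)
    sound (¬I (n , f) d Γ⊆αΘ Θ-NEfree) s H = unsupported-｛｝⇒⫤ n f λ w x a →
      ⊨⊥f⇒Empty (sound d ｛ w ｝ (anti-mono Γ⊆αΘ (a ∷ ⊨*-downClosed Θ-NEfree (∈⇒｛｝⊆ x) H))) w refl
    sound (¬E {Γ} (nα , _) (nβ , _) d₁ d₂) s H =
      ⊨-empty nβ (⊨-⫤-disjoint nα (sound d₁ s (++⁻ˡ Γ H)) (sound d₂ s (++⁻ʳ Γ H)))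
    sound (¬¬E d) s H = sound d s H
    sound (¬¬I d) s H = sound d s H
    sound (dm∧₁ d) s H = sound d s H
    sound (dm∧₂ d) s H = sound d s H
    sound (dm∨₁ d) s H = sound d s H
    sound (dm∨₂ d) s H = sound d s H
    sound (¬NE₁ d) s H = ⊨-empty ⊥f-NEfree (lower (sound d s H))
    sound (¬NE₂ d) s H = lift (⊨⊥f⇒Empty (sound d s H))
    sound (∨I n d) s H = s , ∅ , ≡∪-∅ , sound d s H , ⊨-empty n (λ _ ())
    sound (∨Idem d) s H = s , s , ≡∪-idem , sound d s H , sound d s H
    sound (∨Comm d) s H with sound d s H
    ... | t , u , e , a , b = u , t , ≡∪-comm e , b , a
    sound (∨E {Γ} d d₁ Δ₁⊆φΘ d₂ Δ₂⊆ψΘ Θ-NEfree χ-⊔free) s H with sound d s (++⁻ˡ Γ H)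
    ... | t , u , e , a , b = ⊨-unionClosed χ-⊔free e
      (sound d₁ t (anti-mono Δ₁⊆φΘ (a ∷ ⊨*-downClosed Θ-NEfree (≡∪⇒⊇ˡ e) (++⁻ʳ Γ H))))
      (sound d₂ u (anti-mono Δ₂⊆ψΘ (b ∷ ⊨*-downClosed Θ-NEfree (≡∪⇒⊇ʳ e) (++⁻ʳ Γ H))))
    sound (∨Mon {Γ} d d′ Δ⊆ψΘ Θ-NEfree) s H with sound d s (++⁻ˡ Γ H)
    ... | t , u , e , a , b =
      t , u , e , a , sound d′ u (anti-mono Δ⊆ψΘ (b ∷ ⊨*-downClosed Θ-NEfree (≡∪⇒⊇ʳ e) (++⁻ʳ Γ H)))
    sound (⊥∨ {φ = φ} d) s H with sound d s H
    ... | t , u , e , a , b = ⊨-resp-≐ φ (≡∪⇒⊇ʳ e) (≡∪-emptyˡ e (⊨⊥f⇒Empty a)) b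
    sound (⊥⊥∨ d) s H with sound d s H
    ... | _ , _ , _ , (a , lift (w , x)) , _ = ⊥-elim (⊨⊥f⇒Empty a w x)
    sound (◇Mon d′ Δ⊆φ d) s H w x with sound d s H w x
    ... | t , t⊆Rw , ne , a = t , t⊆Rw , ne , sound d′ t (anti-mono Δ⊆φ (a ∷ []))
    sound (□Mon d′ Δ⊆φs dd) s H w x = sound d′ (R w) (anti-mono Δ⊆φs (sound□ dd s H w x))
    sound (¬◇₁ d) s H = sound d s H
    sound (¬◇₂ d) s H = sound d s H
    sound (◇NE d) s H w x with sound d s H w x
    ... | _ , t⊆Rw , _ , (_ , t₂ , e , _ , (b , lift ne)) = t₂ , (λ v → t⊆Rw v ∘ ≡∪⇒⊇ʳ e v) , ne , b
    sound (◇∨ {Γ} d₁ d₂) s H w x with sound d₁ s (++⁻ˡ Γ H) w x | sound d₂ s (++⁻ʳ Γ H) w x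
    ... | t , t⊆Rw , (v , y) , a | t′ , t′⊆Rw , _ , b =
      t ∪ t′ , (λ v → [ t⊆Rw v , t′⊆Rw v ]) , (v , inj₁ y) , t , t′ , ≡∪-refl , a , b
    sound (□NE d) s H w x with sound d s H w x
    ... | a , lift ne = R w , (λ _ wRv → wRv) , ne , a
    sound (□◇∨ {Γ} d₁ d₂) s H w x with sound d₂ s (++⁻ʳ Γ H) w x
    ... | t , t⊆Rw , _ , b = R w , t , ≡∪-absorbʳ t⊆Rw , sound d₁ s (++⁻ˡ Γ H) w x , b
    sound (⊔I₁ d) s H = inj₁ (sound d s H)
    sound (⊔I₂ d) s H = inj₂ (sound d s H)
    sound (⊔E {Γ} d d₁ Δ₁⊆φΘ d₂ Δ₂⊆ψΘ) s H =
      [ (λ a → sound d₁ s (anti-mono Δ₁⊆φΘ (a ∷ ++⁻ʳ Γ H))) ,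
        (λ b → sound d₂ s (anti-mono Δ₂⊆ψΘ (b ∷ ++⁻ʳ Γ H))) ] (sound d s (++⁻ˡ Γ H))
    sound (∨⊔Distr d) s H with sound d s H
    ... | t , u , e , a , inj₁ b = inj₁ (t , u , e , a , b)
    ... | t , u , e , a , inj₂ c = inj₂ (t , u , e , a , c)
    sound (¬⊔₁ d) s H = sound d s H
    sound (¬⊔₂ d) s H = sound d s H
    sound ⊥⊔NE s H with em {P = Satisfiable s}
    ... | yes ne = inj₂ (lift ne)
    ... | no ¬ne = inj₁ (⊨-empty ⊥f-NEfree λ w x → ¬ne (w , x))
    sound (◇⊔₁ {φ = φ} {ψ} d) s H = ≡∪-split (λ w → PossiblyAt-⊔⁻ {φ} {ψ} ∘ sound d s H w)
    sound (◇⊔₂ {φ = φ} {ψ} d) s H w x with sound d s H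
    ... | _ , _ , e , a , b = PossiblyAt-⊔⁺ {φ} {ψ} (Sum.map (a w) (b w) (≡∪⇒⊆ e w x))
    sound (□⊔₁ d) s H = ≡∪-split (sound d s H)
    sound (□⊔₂ d) s H w x with sound d s H
    ... | _ , _ , e , a , b = Sum.map (a w) (b w) (≡∪⇒⊆ e w x)

    sound□ : ∀ {Γ φs} → Γ ⊢□* φs → ∀ s → s ⊨* Γ → ∀ w → w ∈ s → R w ⊨* φs
    sound□ [] s H w x = []
    sound□ (_∷_ {Γ} d dd) s H w x = sound d s (++⁻ˡ Γ H) w x ∷ sound□ dd s (++⁻ʳ Γ H) w x

theorem4p3 : (∀ {ℓ} → ExcludedMiddle ℓ) →
             ∀ (Φ : Form → Set) (ψ : Form) → Φ ⊢ₛ ψ → Φ ⊨ₛ ψ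
theorem4p3 em _ _ (Γ , Γ⊆Φ , d) M s s⊨Φ = Classical.sound em d s (All.map (s⊨Φ _) Γ⊆Φ)
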